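{- Let $F:U_n\to\mathbb{R}$ be a carriage-wise polynomial function (with polynomials $P_i$ attached to carriages $S_i$) that is invariant under cluster mutations, i.e. $F(\mu_k(X))=F(X)$ for all $X\in U_n$ and all $k$. Suppose two carriages $S_{i_1}$ and $S_{i_2}$ differ in the sign of exactly one entry $x_{i,j}$, and there exists a vertex $k$ such that the entries $x_{i,k}$ and $x_{k,j}$ have the same sign in these carriages. Then the polynomials $P_{i_1}$ and $P_{i_2}$ coincide.
   Context: An $n$-quiver is a real skew-symmetric $n\times n$ matrix $X=(x_{i,j})$; $U_n$ denotes the set of all $n$-quivers. A carriage is a subset of $U_n$ consisting of all quivers whose entries $x_{i,j}$ ($i<j$) have prescribed signs (each prescribed to be $\ge 0$ or $\le 0$), so $U_n$ is covered by $2^{\binom n2}$ carriages $S_i$. A function $F:U_n\to\mathbb{R}$ is carriage-wise polynomial if to each carriage $S_i$ there corresponds a polynomial $P_i$ in the entries $x_{1,2},\dots,x_{n-1,n}$ such that $F(X)=P_i(X)$ for all $X\in S_i$. For $k\in\{1,\dots,n\}$ the cluster mutation $\mu_k:U_n\to U_n$ is defined entrywise: $x_{i,j}\mapsto -x_{i,j}$ if $k\in\{i,j\}$; if $k\ne i,j$, then $x_{i,j}\mapsto x_{i,j}+x_{i,k}x_{k,j}$ if $x_{i,k}>0$ and $x_{k,j}>0$, $x_{i,j}\mapsto x_{i,j}-x_{i,k}x_{k,j}$ if $x_{i,k}<0$ and $x_{k,j}<0$, and $x_{i,j}\mapsto x_{i,j}$ otherwise. -}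

module Defs where

open import Level using (0ℓ)
open import Data.Bool using (Bool; true; false; not; if_then_else_)
open import Data.Empty using (⊥)
open import Data.Nat using (ℕ)
open import Data.Fin as Fin using (Fin)
open import Data.Fin.Properties using (<-cmp)
open import Data.Product using (Σ; ∃; _×_; _,_)
open import Data.Sum using (_⊎_)
open import Relation.Nullary using (¬_; yes; no)
open import Relation.Binary.Definitions using (tri<; tri≈; tri>)
open import Relation.Binary.PropositionalEquality using (_≡_; _≢_)
open import Algebra.Structures using (IsCommutativeRing)
open import Relation.Binary.Structures using (IsStrictTotalOrder)

-- An axiomatic model of the real numbers: a complete ordered field.
-- (Any two such are isomorphic, so quantifying over all of them is the
-- same as speaking about ℝ.)

record Reals : Set₁ where
  infixl 6 _+_
  infixl 7 _*_
  infix  4 _<_ _≤_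
  field
    ℝ   : Set
    0ℝ 1ℝ : ℝ
    _+_ _*_ : ℝ → ℝ → ℝ
    -_  : ℝ → ℝ
    _<_ : ℝ → ℝ → Set
    isCommutativeRing : IsCommutativeRing _≡_ _+_ _*_ -_ 0ℝ 1ℝ
    0≢1 : 0ℝ ≢ 1ℝ
    inverse : ∀ x → x ≢ 0ℝ → ∃ λ y → x * y ≡ 1ℝ
    isStrictTotalOrder : IsStrictTotalOrder _≡_ _<_
    +-mono-< : ∀ {x y} z → x < y → x + z < y + z
    *-pos : ∀ {x y} → 0ℝ < x → 0ℝ < y → 0ℝ < x * y

  _≤_ : ℝ → ℝ → Set
  x ≤ y = x < y ⊎ x ≡ y

  field
    complete : (S : ℝ → Set) → (∃ λ x → S x) → (∃ λ b → ∀ x → S x → x ≤ b) →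
               ∃ λ s → (∀ x → S x → x ≤ s) × (∀ b → (∀ x → S x → x ≤ b) → s ≤ b)

  compare = IsStrictTotalOrder.compare isStrictTotalOrder

module Quivers (R : Reals) where
  open Reals R

  -- An n-quiver is determined by its entries x_{i,j}, i < j; the
  -- remaining entries are given by skew-symmetry (x_{j,i} = - x_{i,j},
  -- x_{i,i} = 0).  U n is the set of n-quivers.
  U : (n : ℕ) → Set
  U n = (i j : Fin n) → i Fin.< j → ℝ

  entry : ∀ {n} → U n → Fin n → Fin n → ℝ
  entry X i j with <-cmp i j
  ... | tri< p _ _ = X i j p
  ... | tri≈ _ _ _ = 0ℝ
  ... | tri> _ _ p = - X j i p

  μ : ∀ {n} → Fin n → U n → U n
  μ k X i j p with k Fin.≟ i | k Fin.≟ j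
  ... | yes _ | _     = - X i j p
  ... | no _  | yes _ = - X i j p
  ... | no _  | no _  with compare 0ℝ (entry X i k) | compare 0ℝ (entry X k j)
  ...   | tri< _ _ _ | tri< _ _ _ = X i j p + entry X i k * entry X k j
  ...   | tri> _ _ _ | tri> _ _ _ = X i j p + - (entry X i k * entry X k j)
  ...   | _          | _          = X i j p

  data Poly (n : ℕ) : Set where
    con : ℝ → Poly n
    var : (i j : Fin n) → i Fin.< j → Poly n
    _⊕_ : Poly n → Poly n → Poly n
    _⊗_ : Poly n → Poly n → Poly n

  eval : ∀ {n} → Poly n → U n → ℝ
  eval (con c) X = c
  eval (var i j p) X = X i j p
  eval (P ⊕ Q) X = eval P X + eval Q X
  eval (P ⊗ Q) X = eval P X * eval Q X

  -- A carriage is given by a sign pattern: s i j p = true prescribes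
  -- x_{i,j} ≥ 0, false prescribes x_{i,j} ≤ 0.
  SignPattern : ℕ → Set
  SignPattern n = (i j : Fin n) → i Fin.< j → Bool

  _∈Carriage_ : ∀ {n} → U n → SignPattern n → Set
  X ∈Carriage s = ∀ i j p → if s i j p then 0ℝ ≤ X i j p else X i j p ≤ 0ℝ

  signEntry : ∀ {n} → SignPattern n → Fin n → Fin n → Bool
  signEntry s a b with <-cmp a b
  ... | tri< p _ _ = s a b p
  ... | tri≈ _ _ _ = true
  ... | tri> _ _ p = not (s b a p)

  CarriagewisePolynomial : ∀ {n} → (U n → ℝ) → (SignPattern n → Poly n) → Set
  CarriagewisePolynomial F P = ∀ s X → X ∈Carriage s → F X ≡ eval (P s) X

  MutationInvariant : ∀ {n} → (U n → ℝ) → Set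
  MutationInvariant {n} F = ∀ (X : U n) k → F (μ k X) ≡ F X

  DifferExactlyAt : ∀ {n} → SignPattern n → SignPattern n → (i j : Fin n) → i Fin.< j → Set
  DifferExactlyAt s₁ s₂ i j p =
    (s₁ i j p ≢ s₂ i j p) ×
    (∀ a b q → ¬ (a ≡ i × b ≡ j) → s₁ a b q ≡ s₂ a b q)

{-# OPTIONS --safe #-}
module Submission where

-- Work on the open region where x_{i,j} is free and every other entry has the strict
-- sign prescribed by S_{i1}.  Let X_t be X with x_{i,j} replaced by t.  There x_{i,k}
-- and x_{k,j} share a strict sign σ, so μ_k(X_t) = (μ_k X)_{t+δ} with δ = ±x_{i,k}x_{k,j}
-- of sign σ.  Let T be the sign pattern of μ_k X with sign σ put at (i,j).  For either
-- carriage S of the two, infinitely many t put X_t in S and (μ_k X)_{t+δ} in T, and there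
-- P_S(X_t) = F(X_t) = F(μ_k X_t) = P_T((μ_k X)_{t+δ}).  Both sides are polynomials in t,
-- so this holds for every t, and t = x_{i,j} gives P_{i1}(X) = P_{i2}(X) on the region.
-- A polynomial identity on a nonempty open set holds everywhere: release the sign
-- constraints one coordinate at a time, again counting roots in one variable.

open import Defs
open import Level using (0ℓ)
open import Algebra using (CommutativeRing)
open import Data.Bool using (Bool; true; false; not; if_then_else_)
open import Data.Empty using (⊥-elim)
open import Data.Fin as Fin using (Fin)
open import Data.Fin.Properties using (_≟_; _<?_; <-cmp; <-irrelevant)
open import Data.List using (List; []; _∷_; [_]; _++_; allFin; cartesianProduct)
open import Data.List.Membership.Propositional using (_∉_)
open import Data.List.Membership.Propositional.Properties
  using (∈-++⁺ˡ; ∈-cartesianProduct⁺; ∈-allFin)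
open import Data.List.Relation.Unary.Any using (here; there)
open import Data.Nat as ℕ using (ℕ; zero; suc; z≤n; s≤s)
import Data.Nat.Properties as ℕ
open import Data.Product using (Σ; ∃; _×_; _,_; proj₁; proj₂)
open import Data.Product.Properties using (≡-dec; ×-≡,≡→≡)
open import Data.Sum using (inj₁; inj₂)
open import Function using (_∘_)
open import Function.Definitions using (Injective)
open import Relation.Binary.Definitions using (tri<; tri≈; tri>)
open import Relation.Binary.PropositionalEquality hiding ([_])
open import Relation.Binary.Structures using (IsStrictTotalOrder)
open import Relation.Nullary using (¬_; Dec; yes; no)

module OrderedField (R : Reals) where
  open Reals R

  ℝ-commutativeRing : CommutativeRing 0ℓ 0ℓ
  ℝ-commutativeRing = record { isCommutativeRing = isCommutativeRing }

  open CommutativeRing ℝ-commutativeRing public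
    using (+-comm; +-assoc; +-identityˡ; +-identityʳ; -‿inverseˡ; -‿inverseʳ;
           *-comm; *-assoc; *-identityˡ; *-identityʳ; zeroʳ; distribʳ; commutativeSemiring)
  open import Algebra.Properties.Ring (CommutativeRing.ring ℝ-commutativeRing) public
    using (-‿distribˡ-*; -‿distribʳ-*; x[y-z]≈xy-xz; [y-z]x≈yx-zx; -1*x≈-x; -‿involutive;
           x∙y⁻¹≈ε⇒x≈y; x≈y⇒x∙y⁻¹≈ε)
  open IsStrictTotalOrder isStrictTotalOrder using (asym) renaming (trans to <-trans)

  <-irrefl : ∀ {x} → ¬ x < x
  <-irrefl = IsStrictTotalOrder.irrefl isStrictTotalOrder refl

  <⇒≢ : ∀ {x y} → x < y → x ≢ y
  <⇒≢ x<x refl = <-irrefl x<x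

  x<y⇒0<y-x : ∀ {x y} → x < y → 0ℝ < y + - x
  x<y⇒0<y-x {x} {y} x<y = subst (_< y + - x) (-‿inverseʳ x) (+-mono-< (- x) x<y)

  x-y+y≡x : ∀ x y → x + - y + y ≡ x
  x-y+y≡x x y = trans (+-assoc x (- y) y) (trans (cong (x +_) (-‿inverseˡ y)) (+-identityʳ x))

  0<y-x⇒x<y : ∀ {x y} → 0ℝ < y + - x → x < y
  0<y-x⇒x<y {x} {y} 0<y-x = subst₂ _<_ (+-identityˡ x) (x-y+y≡x y x) (+-mono-< x 0<y-x)

  0<x⇒-x<0 : ∀ {x} → 0ℝ < x → - x < 0ℝ
  0<x⇒-x<0 {x} 0<x = subst₂ _<_ (+-identityˡ (- x)) (-‿inverseʳ x) (+-mono-< (- x) 0<x)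

  x<0⇒0<-x : ∀ {x} → x < 0ℝ → 0ℝ < - x
  x<0⇒0<-x {x} x<0 = subst₂ _<_ (-‿inverseʳ x) (+-identityˡ (- x)) (+-mono-< (- x) x<0)

  -x*-y≡x*y : ∀ x y → - x * - y ≡ x * y
  -x*-y≡x*y x y = begin
    - x * - y      ≡⟨ -‿distribˡ-* x (- y) ⟨
    - (x * - y)    ≡⟨ cong -_ (-‿distribʳ-* x y) ⟨
    - (- (x * y))  ≡⟨ -‿involutive (x * y) ⟩
    x * y          ∎
    where open ≡-Reasoning

  0<1 : 0ℝ < 1ℝ
  0<1 with compare 0ℝ 1ℝ
  ... | tri< 0<1 _ _ = 0<1
  ... | tri≈ _ 0≡1 _ = ⊥-elim (0≢1 0≡1)
  ... | tri> _ _ 1<0 = ⊥-elim (asym 1<0 (subst (0ℝ <_) 1*1≡1 (*-pos 0<-1 0<-1)))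
    where
    0<-1 = x<0⇒0<-x 1<0
    1*1≡1 = trans (-x*-y≡x*y 1ℝ 1ℝ) (*-identityʳ 1ℝ)

  *-monoʳ-< : ∀ {e x y} → 0ℝ < e → x < y → x * e < y * e
  *-monoʳ-< {e} {x} {y} 0<e x<y =
    0<y-x⇒x<y (subst (0ℝ <_) ([y-z]x≈yx-zx e y x) (*-pos (x<y⇒0<y-x x<y) 0<e))

  *-cancelˡ : ∀ {x y z} → x ≢ 0ℝ → x * y ≡ x * z → y ≡ z
  *-cancelˡ {x} {y} {z} x≢0 xy≡xz with inverse x x≢0
  ... | x⁻¹ , xx⁻¹≡1 = begin
    y                ≡⟨ *-identityˡ y ⟨
    1ℝ * y           ≡⟨ cong (_* y) (trans (sym xx⁻¹≡1) (*-comm x x⁻¹)) ⟩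
    x⁻¹ * x * y      ≡⟨ *-assoc x⁻¹ x y ⟩
    x⁻¹ * (x * y)    ≡⟨ cong (x⁻¹ *_) xy≡xz ⟩
    x⁻¹ * (x * z)    ≡⟨ *-assoc x⁻¹ x z ⟨
    x⁻¹ * x * z      ≡⟨ cong (_* z) (trans (*-comm x⁻¹ x) xx⁻¹≡1) ⟩
    1ℝ * z           ≡⟨ *-identityˡ z ⟩
    z                ∎
    where open ≡-Reasoning

  x≢y⇒x-y≢0 : ∀ {x y} → x ≢ y → x + - y ≢ 0ℝ
  x≢y⇒x-y≢0 x≢y x-y≡0 = x≢y (x∙y⁻¹≈ε⇒x≈y _ _ x-y≡0)

  StrictSign : Bool → ℝ → Set
  StrictSign true  x = 0ℝ < x
  StrictSign false x = x < 0ℝ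

  WeakSign : Bool → ℝ → Set
  WeakSign b x = if b then 0ℝ ≤ x else x ≤ 0ℝ

  signed : Bool → ℝ → ℝ
  signed true  x = x
  signed false x = - x

  strict⇒weak : ∀ b {x} → StrictSign b x → WeakSign b x
  strict⇒weak true  = inj₁
  strict⇒weak false = inj₁

  weakSign-0 : ∀ b → WeakSign b 0ℝ
  weakSign-0 true  = inj₂ refl
  weakSign-0 false = inj₂ refl

  strict⇒≢0 : ∀ b {x} → StrictSign b x → x ≢ 0ℝ
  strict⇒≢0 true  0<x = <⇒≢ 0<x ∘ sym
  strict⇒≢0 false x<0 = <⇒≢ x<0

  strict-neg : ∀ b {x} → StrictSign b x → StrictSign (not b) (- x)
  strict-neg true  = 0<x⇒-x<0
  strict-neg false = x<0⇒0<-x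

  strict-+ : ∀ b {x y} → StrictSign b x → StrictSign b y → StrictSign b (x + y)
  strict-+ true  {x} {y} 0<x 0<y = <-trans 0<y (subst (_< x + y) (+-identityˡ y) (+-mono-< y 0<x))
  strict-+ false {x} {y} x<0 y<0 = <-trans (subst (x + y <_) (+-identityˡ y) (+-mono-< y x<0)) y<0

  strict-*-pos : ∀ b {x e} → StrictSign b x → 0ℝ < e → StrictSign b (x * e)
  strict-*-pos true  0<x 0<e = *-pos 0<x 0<e
  strict-*-pos false {x} {e} x<0 0<e = subst (_< 0ℝ) -[-x*e]≡x*e (0<x⇒-x<0 (*-pos (x<0⇒0<-x x<0) 0<e))
    where
    -[-x*e]≡x*e : - (- x * e) ≡ x * e
    -[-x*e]≡x*e = trans (cong -_ (sym (-‿distribˡ-* x e))) (-‿involutive (x * e))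

  weak-*-nonneg : ∀ b {x e} → StrictSign b x → 0ℝ ≤ e → WeakSign b (x * e)
  weak-*-nonneg b x-sign (inj₁ 0<e) = strict⇒weak b (strict-*-pos b x-sign 0<e)
  weak-*-nonneg b {x} x-sign (inj₂ refl) = subst (WeakSign b) (sym (zeroʳ x)) (weakSign-0 b)

  strict-*-strict : ∀ b {x y} → StrictSign b x → StrictSign b y → 0ℝ < x * y
  strict-*-strict true  0<x 0<y = *-pos 0<x 0<y
  strict-*-strict false {x} {y} x<0 y<0 = subst (0ℝ <_) (-x*-y≡x*y x y) (*-pos (x<0⇒0<-x x<0) (x<0⇒0<-x y<0))

  strict-signed : ∀ b {x} → 0ℝ < x → StrictSign b (signed b x)
  strict-signed true  = λ 0<x → 0<x
  strict-signed false = 0<x⇒-x<0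

  0<2 : 0ℝ < 1ℝ + 1ℝ
  0<2 = strict-+ true 0<1 0<1

  half : ∃ λ h → 0ℝ < h × h < 1ℝ
  half with inverse (1ℝ + 1ℝ) (<⇒≢ 0<2 ∘ sym)
  ... | h , 2h≡1 = h , 0<h , subst (h <_) h+h≡1 (subst (_< h + h) (+-identityˡ h) (+-mono-< h 0<h))
    where
    h+h≡1 : h + h ≡ 1ℝ
    h+h≡1 = trans (cong₂ _+_ (sym (*-identityˡ h)) (sym (*-identityˡ h))) (trans (sym (distribʳ h 1ℝ 1ℝ)) 2h≡1)
    0<h : 0ℝ < h
    0<h with compare 0ℝ h
    ... | tri< 0<h _ _ = 0<h
    ... | tri≈ _ 0≡h _ = ⊥-elim (0≢1 (trans (sym (zeroʳ (1ℝ + 1ℝ))) (trans (cong (_ *_) 0≡h) 2h≡1)))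
    ... | tri> _ _ h<0 = ⊥-elim (asym 0<1 (subst (_< 0ℝ) (trans (*-comm h _) 2h≡1)
                                  (strict-*-pos false h<0 0<2)))

  h : ℝ
  h = proj₁ half

  h^ : ℕ → ℝ
  h^ zero    = 1ℝ
  h^ (suc m) = h * h^ m

  0<h^ : ∀ m → 0ℝ < h^ m
  0<h^ zero    = 0<1
  0<h^ (suc m) = *-pos (proj₁ (proj₂ half)) (0<h^ m)

  h^-suc< : ∀ m → h^ (suc m) < h^ m
  h^-suc< m = subst (h * h^ m <_) (*-identityˡ (h^ m)) (*-monoʳ-< (0<h^ m) (proj₂ (proj₂ half)))

  h^-antimono : ∀ {m m'} → m ℕ.< m' → h^ m' < h^ m
  h^-antimono {m} {suc m'} (s≤s m≤m') with ℕ.m≤n⇒m<n∨m≡n m≤m'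
  ... | inj₁ m<m' = <-trans (h^-suc< m') (h^-antimono m<m')
  ... | inj₂ refl = h^-suc< m

  h^≤1 : ∀ m → h^ m ≤ 1ℝ
  h^≤1 zero    = inj₂ refl
  h^≤1 (suc m) = inj₁ (h^-antimono {0} {suc m} (s≤s z≤n))

  h^-injective : Injective _≡_ _≡_ h^
  h^-injective {m} {m'} h^m≡h^m' with ℕ.<-cmp m m'
  ... | tri< m<m' _ _ = ⊥-elim (<⇒≢ (h^-antimono m<m') (sym h^m≡h^m'))
  ... | tri≈ _ m≡m' _ = m≡m'
  ... | tri> _ _ m'<m = ⊥-elim (<⇒≢ (h^-antimono m'<m) h^m≡h^m')

  scaled-points : ∀ b {x} → StrictSign b x →
    Injective _≡_ _≡_ (λ m → x * h^ m) × (∀ m → StrictSign b (x * h^ m))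
  scaled-points b x-sign =
    (λ eq → h^-injective (*-cancelˡ (strict⇒≢0 b x-sign) eq)) ,
    (λ m → strict-*-pos b x-sign (0<h^ m))

  same-sign-points : ∀ σ {δ} → StrictSign σ δ → Σ (ℕ → ℝ) λ c →
    Injective _≡_ _≡_ c × (∀ m → WeakSign σ (c m) × WeakSign σ (c m + δ))
  same-sign-points σ {δ} δ-sign = (λ m → δ * h^ m) , proj₁ points , λ m →
    strict⇒weak σ (proj₂ points m) , strict⇒weak σ (strict-+ σ (proj₂ points m) δ-sign)
    where points = scaled-points σ δ-sign

  opposite-sign-points : ∀ σ {δ} → StrictSign σ δ → Σ (ℕ → ℝ) λ c →
    Injective _≡_ _≡_ c × (∀ m → WeakSign (not σ) (c m) × WeakSign σ (c m + δ))
  opposite-sign-points σ {δ} δ-sign = (λ m → - δ * h^ m) , proj₁ points , λ m →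
    strict⇒weak (not σ) (proj₂ points m) ,
    subst (WeakSign σ) (δ[1-h^m]≡-δh^m+δ m) (weak-*-nonneg σ δ-sign (0≤1-h^ m))
    where
    points = scaled-points (not σ) (strict-neg σ δ-sign)
    0≤1-h^ : ∀ m → 0ℝ ≤ 1ℝ + - h^ m
    0≤1-h^ m with h^≤1 m
    ... | inj₁ h^m<1  = inj₁ (x<y⇒0<y-x h^m<1)
    ... | inj₂ h^m≡1 = inj₂ (sym (trans (cong (λ x → 1ℝ + - x) h^m≡1) (-‿inverseʳ 1ℝ)))
    δ[1-h^m]≡-δh^m+δ : ∀ m → δ * (1ℝ + - h^ m) ≡ - δ * h^ m + δ
    δ[1-h^m]≡-δh^m+δ m = begin
      δ * (1ℝ + - h^ m)      ≡⟨ x[y-z]≈xy-xz δ 1ℝ (h^ m) ⟩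
      δ * 1ℝ + - (δ * h^ m)  ≡⟨ cong (_+ - (δ * h^ m)) (*-identityʳ δ) ⟩
      δ + - (δ * h^ m)       ≡⟨ +-comm δ _ ⟩
      - (δ * h^ m) + δ       ≡⟨ cong (_+ δ) (-‿distribˡ-* δ (h^ m)) ⟩
      - δ * h^ m + δ         ∎
      where open ≡-Reasoning

  translation-points : ∀ σ {δ} → StrictSign σ δ → ∀ b → Σ (ℕ → ℝ) λ c →
    Injective _≡_ _≡_ c × (∀ m → WeakSign b (c m) × WeakSign σ (c m + δ))
  translation-points true  δ-sign true  = same-sign-points true δ-sign
  translation-points false δ-sign false = same-sign-points false δ-sign
  translation-points true  δ-sign false = opposite-sign-points true δ-sign
  translation-points false δ-sign true  = opposite-sign-points false δ-sign

module PolynomialFunctions (R : Reals) where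
  open Reals R
  open OrderedField R
  open import Algebra.Solver.Ring.NaturalCoefficients.Default commutativeSemiring

  -- Horner schemes, with pointwise equations since function extensionality is unavailable.
  data Degree≤ : ℕ → (ℝ → ℝ) → Set where
    const  : ∀ {g} c → (∀ t → g t ≡ c) → Degree≤ 0 g
    horner : ∀ {d g} c {k} → Degree≤ d k → (∀ t → g t ≡ c + t * k t) → Degree≤ (suc d) g

  degree-cong : ∀ {d g g'} → Degree≤ d g → (∀ t → g' t ≡ g t) → Degree≤ d g'
  degree-cong (const c g≡c)        g'≡g = const c (λ t → trans (g'≡g t) (g≡c t))
  degree-cong (horner c Dk g≡c+tk) g'≡g = horner c Dk (λ t → trans (g'≡g t) (g≡c+tk t))

  degree-suc : ∀ {d g} → Degree≤ d g → Degree≤ (suc d) g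
  degree-suc (const c g≡c) =
    horner c (const 0ℝ λ _ → refl) (λ t → trans (g≡c t) (solve 2 (λ c t → c := c :+ t :* con 0) refl c t))
  degree-suc (horner c Dk g≡c+tk) = horner c (degree-suc Dk) g≡c+tk

  degree-≤ : ∀ {d d' g} → d ℕ.≤ d' → Degree≤ d g → Degree≤ d' g
  degree-≤ {d' = zero}  z≤n D = D
  degree-≤ {d' = suc _} z≤n D = degree-suc (degree-≤ z≤n D)
  degree-≤ (s≤s d≤d') (horner c Dk g≡c+tk) = horner c (degree-≤ d≤d' Dk) g≡c+tk

  degree-+ : ∀ {d u v} → Degree≤ d u → Degree≤ d v → Degree≤ d (λ t → u t + v t)
  degree-+ (const c u≡c) (const c' v≡c') = const (c + c') (λ t → cong₂ _+_ (u≡c t) (v≡c' t))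
  degree-+ (horner c {k} Dk u≡) (horner c' {k'} Dk' v≡) = horner (c + c') (degree-+ Dk Dk') λ t →
    trans (cong₂ _+_ (u≡ t) (v≡ t))
      (solve 5 (λ c c' t k k' → (c :+ t :* k) :+ (c' :+ t :* k') := (c :+ c') :+ t :* (k :+ k'))
        refl c c' t (k t) (k' t))

  degree-scale : ∀ {d u} a → Degree≤ d u → Degree≤ d (λ t → a * u t)
  degree-scale a (const c u≡c) = const (a * c) (λ t → cong (a *_) (u≡c t))
  degree-scale a (horner c {k} Dk u≡) = horner (a * c) (degree-scale a Dk) λ t →
    trans (cong (a *_) (u≡ t))
      (solve 4 (λ a c t k → a :* (c :+ t :* k) := a :* c :+ t :* (a :* k)) refl a c t (k t))

  degree-neg : ∀ {d u} → Degree≤ d u → Degree≤ d (λ t → - u t)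
  degree-neg Du = degree-cong (degree-scale (- 1ℝ) Du) (λ t → sym (-1*x≈-x _))

  degree-* : ∀ {d₁ d₂ u v} → Degree≤ d₁ u → Degree≤ d₂ v → Degree≤ (d₁ ℕ.+ d₂) (λ t → u t * v t)
  degree-* (const c u≡c) Dv = degree-cong (degree-scale c Dv) (λ t → cong (_* _) (u≡c t))
  degree-* {suc d₁} {d₂} {v = v} (horner c {k} Dk u≡) Dv =
    degree-cong (degree-+ (degree-≤ (ℕ.m≤n+m d₂ (suc d₁)) (degree-scale c Dv))
                          (horner 0ℝ (degree-* Dk Dv) (λ _ → sym (+-identityˡ _))))
      λ t → trans (cong (_* v t) (u≡ t))
        (solve 4 (λ c t k v → (c :+ t :* k) :* v := c :* v :+ t :* (k :* v)) refl c t (k t) (v t))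

  factor-theorem : ∀ {d g} → Degree≤ d g → ∀ a →
    ∃ λ q → Degree≤ (ℕ.pred d) q × (∀ t → g t ≡ g a + (t + - a) * q t)
  factor-theorem (const c g≡c) a =
    (λ _ → 0ℝ) , const 0ℝ (λ _ → refl) ,
    λ t → trans (g≡c t) (sym (trans (cong₂ _+_ (g≡c a) (zeroʳ _)) (+-identityʳ c)))
  factor-theorem {suc d} {g} (horner c {k} Dk g≡) a with factor-theorem Dk a
  ... | l , Dl , k≡ = (λ t → k t + a * l t) ,
    degree-+ Dk (degree-≤ ℕ.pred[n]≤n (degree-scale a Dl)) ,
    λ t → let y = t + - a in begin
      g t                                          ≡⟨ g≡ t ⟩
      c + t * k t                                  ≡⟨ cong₂ (λ x z → c + x * z) (t≡a+[t-a] t) (k≡ t) ⟩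
      -- in terms of y = t - a the identity is free of subtraction, hence a semiring identity
      c + (a + y) * (k a + y * l t)                ≡⟨ solve 5 (λ c a y ka l →
                                                        c :+ (a :+ y) :* (ka :+ y :* l)
                                                     := (c :+ a :* ka) :+ y :* ((ka :+ y :* l) :+ a :* l))
                                                      refl c a y (k a) (l t) ⟩
      (c + a * k a) + y * ((k a + y * l t) + a * l t)  ≡⟨ cong₂ (λ x z → x + y * (z + a * l t)) (sym (g≡ a)) (sym (k≡ t)) ⟩
      g a + y * (k t + a * l t)                    ∎
    where
    open ≡-Reasoning
    t≡a+[t-a] : ∀ t → t ≡ a + (t + - a)
    t≡a+[t-a] t = sym (trans (+-comm a _) (x-y+y≡x t a))

  vanish : ∀ {d g} → Degree≤ d g → (p : ℕ → ℝ) → Injective _≡_ _≡_ p →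
    (∀ m → g (p m) ≡ 0ℝ) → ∀ t → g t ≡ 0ℝ
  vanish {zero} (const c g≡c) p _ g∘p≡0 t = trans (g≡c t) (trans (sym (g≡c (p 0))) (g∘p≡0 0))
  vanish {suc d} {g} Dg p p-inj g∘p≡0 t with factor-theorem Dg (p 0)
  ... | q , Dq , g≡ = begin
    g t                         ≡⟨ g≡ t ⟩
    g (p 0) + (t + - p 0) * q t ≡⟨ cong₂ (λ x z → x + (t + - p 0) * z) (g∘p≡0 0) (q≡0 t) ⟩
    0ℝ + (t + - p 0) * 0ℝ       ≡⟨ trans (+-identityˡ _) (zeroʳ _) ⟩
    0ℝ                          ∎
    where
    open ≡-Reasoning
    [p-p₀]*q≡0 : ∀ m → (p (suc m) + - p 0) * q (p (suc m)) ≡ 0ℝ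
    [p-p₀]*q≡0 m = begin
      (p (suc m) + - p 0) * q (p (suc m))            ≡⟨ +-identityˡ _ ⟨
      0ℝ + (p (suc m) + - p 0) * q (p (suc m))       ≡⟨ cong (_+ _) (g∘p≡0 0) ⟨
      g (p 0) + (p (suc m) + - p 0) * q (p (suc m))  ≡⟨ g≡ (p (suc m)) ⟨
      g (p (suc m))                                  ≡⟨ g∘p≡0 (suc m) ⟩
      0ℝ                                             ∎
    q≡0 : ∀ t → q t ≡ 0ℝ
    q≡0 = vanish Dq (p ∘ suc) (ℕ.suc-injective ∘ p-inj) λ m →
      *-cancelˡ (x≢y⇒x-y≢0 (ℕ.0≢1+n ∘ p-inj ∘ sym)) (trans ([p-p₀]*q≡0 m) (sym (zeroʳ _)))

  agree : ∀ {d₁ d₂ u v} → Degree≤ d₁ u → Degree≤ d₂ v → (p : ℕ → ℝ) → Injective _≡_ _≡_ p →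
    (∀ m → u (p m) ≡ v (p m)) → ∀ t → u t ≡ v t
  agree {d₁} {d₂} Du Dv p p-inj u∘p≡v∘p t =
    x∙y⁻¹≈ε⇒x≈y _ _ (vanish Du-v p p-inj (λ m → x≈y⇒x∙y⁻¹≈ε (u∘p≡v∘p m)) t)
    where
    Du-v = degree-+ (degree-≤ (ℕ.m≤m+n d₁ d₂) Du) (degree-≤ (ℕ.m≤n+m d₂ d₁) (degree-neg Dv))

module Coordinates {n : ℕ} where
  _≟₂_ : (x y : Fin n × Fin n) → Dec (x ≡ y)
  _≟₂_ = ≡-dec _≟_ _≟_

  Entries : Set → Set
  Entries A = (a b : Fin n) → a Fin.< b → A

  update : ∀ {A} → Entries A → Fin n → Fin n → A → Entries A
  update f i j x a b q with (a , b) ≟₂ (i , j)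
  ... | yes _ = x
  ... | no  _ = f a b q

  module _ {A : Set} (f : Entries A) {i j : Fin n} (x : A) where
    update-same : ∀ q → update f i j x i j q ≡ x
    update-same q with (i , j) ≟₂ (i , j)
    ... | yes _ = refl
    ... | no ij≢ij = ⊥-elim (ij≢ij refl)

    update-other : ∀ {a b} q → (a , b) ≢ (i , j) → update f i j x a b q ≡ f a b q
    update-other {a} {b} q ab≢ij with (a , b) ≟₂ (i , j)
    ... | yes ab≡ij = ⊥-elim (ab≢ij ab≡ij)
    ... | no  _     = refl

  update-self : ∀ {A} (f : Entries A) {i j} p a b q → update f i j (f i j p) a b q ≡ f a b q
  update-self f {i} {j} p a b q with (a , b) ≟₂ (i , j)
  ... | yes refl = cong (f i j) (<-irrelevant p q)
  ... | no  _    = refl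

module QuiverPolynomials (R : Reals) where
  open Reals R
  open OrderedField R
  open PolynomialFunctions R
  open Quivers R
  open Coordinates

  _≐_ : ∀ {n} → U n → U n → Set
  X ≐ Y = ∀ a b q → X a b q ≡ Y a b q

  eval-cong : ∀ {n} (P : Poly n) {X Y} → X ≐ Y → eval P X ≡ eval P Y
  eval-cong (con c)     X≐Y = refl
  eval-cong (var a b q) X≐Y = X≐Y a b q
  eval-cong (P ⊕ Q)     X≐Y = cong₂ _+_ (eval-cong P X≐Y) (eval-cong Q X≐Y)
  eval-cong (P ⊗ Q)     X≐Y = cong₂ _*_ (eval-cong P X≐Y) (eval-cong Q X≐Y)

  degree : ∀ {n} → Poly n → ℕ
  degree (con _)     = 0
  degree (var _ _ _) = 1
  degree (P ⊕ Q)     = degree P ℕ.+ degree Q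
  degree (P ⊗ Q)     = degree P ℕ.+ degree Q

  eval-update-degree : ∀ {n} (P : Poly n) X a b α →
    Degree≤ (degree P) (λ t → eval P (update X a b (t + α)))
  eval-update-degree (con c) X a b α = const c (λ _ → refl)
  eval-update-degree (var a' b' q) X a b α with (a' , b') ≟₂ (a , b)
  ... | yes _ = horner α (const 1ℝ (λ _ → refl)) (λ t → trans (+-comm t α) (cong (α +_) (sym (*-identityʳ t))))
  ... | no  _ = degree-suc (const (X a' b' q) (λ _ → refl))
  eval-update-degree (P ⊕ Q) X a b α =
    degree-+ (degree-≤ (ℕ.m≤m+n (degree P) (degree Q)) (eval-update-degree P X a b α))
             (degree-≤ (ℕ.m≤n+m (degree Q) (degree P)) (eval-update-degree Q X a b α))
  eval-update-degree (P ⊗ Q) X a b α = degree-* (eval-update-degree P X a b α) (eval-update-degree Q X a b α)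

  eval-update-degree₀ : ∀ {n} (P : Poly n) X a b → Degree≤ (degree P) (λ t → eval P (update X a b t))
  eval-update-degree₀ P X a b =
    degree-cong (eval-update-degree P X a b 0ℝ) (λ t → cong (λ x → eval P (update X a b x)) (sym (+-identityʳ t)))

  StrictExcept : ∀ {n} → SignPattern n → List (Fin n × Fin n) → U n → Set
  StrictExcept s L X = ∀ a b q → (a , b) ∉ L → StrictSign (s a b q) (X a b q)

  module _ {n} (P Q : Poly n) (s : SignPattern n) where
    AgreeOn : List (Fin n × Fin n) → Set
    AgreeOn L = ∀ X → StrictExcept s L X → eval P X ≡ eval Q X

    release : ∀ {L} a b → AgreeOn L → AgreeOn ((a , b) ∷ L)
    release {L} a b agreeL X X∈ with a <? b
    ... | no a≮b = agreeL X λ a' b' q ∉L → X∈ a' b' q λ where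
      (here refl) → a≮b q
      (there ∈L)  → ∉L ∈L
    ... | yes p = begin
      eval P X                         ≡⟨ eval-cong P (update-self X p) ⟨
      eval P (update X a b (X a b p))  ≡⟨ agree (eval-update-degree₀ P X a b) (eval-update-degree₀ Q X a b)
                                                c (proj₁ points) (λ m → agreeL _ (update-strict m)) (X a b p) ⟩
      eval Q (update X a b (X a b p))  ≡⟨ eval-cong Q (update-self X p) ⟩
      eval Q X                         ∎
      where
      open ≡-Reasoning
      σ = s a b p
      c = λ m → signed σ 1ℝ * h^ m
      points = scaled-points σ (strict-signed σ 0<1)
      update-strict : ∀ m → StrictExcept s L (update X a b (c m))
      update-strict m a' b' q ∉L with (a' , b') ≟₂ (a , b)
      ... | yes refl = subst (λ r → StrictSign (s a b r) (c m)) (<-irrelevant p q) (proj₂ points m)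
      ... | no ab≢  = X∈ a' b' q λ where
        (here ab≡) → ab≢ ab≡
        (there ∈L) → ∉L ∈L

    release-all : ∀ {L} L' → AgreeOn L → AgreeOn (L' ++ L)
    release-all []             agreeL = agreeL
    release-all ((a , b) ∷ L') agreeL = release a b (release-all L' agreeL)

    polynomial-identity : ∀ {L} → AgreeOn L → ∀ X → eval P X ≡ eval Q X
    polynomial-identity agreeL X = release-all allPairs agreeL X λ a b q ∉ →
      ⊥-elim (∉ (∈-++⁺ˡ (∈-cartesianProduct⁺ (∈-allFin a) (∈-allFin b))))
      where allPairs = cartesianProduct (allFin n) (allFin n)

module Mutation (R : Reals) where
  open Reals R
  open OrderedField R
  open Quivers R
  open Coordinates
  open QuiverPolynomials R using (_≐_)

  mutationRule : ∀ {n} → Fin n → Fin n → Fin n → ℝ → ℝ → ℝ → ℝ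
  mutationRule k a b x u v with k ≟ a | k ≟ b
  ... | yes _ | _     = - x
  ... | no _  | yes _ = - x
  ... | no _  | no _  with compare 0ℝ u | compare 0ℝ v
  ...   | tri< _ _ _ | tri< _ _ _ = x + u * v
  ...   | tri> _ _ _ | tri> _ _ _ = x + - (u * v)
  ...   | _          | _          = x

  μ-unfold : ∀ {n} k (X : U n) a b q → μ k X a b q ≡ mutationRule k a b (X a b q) (entry X a k) (entry X k b)
  μ-unfold k X a b q with k ≟ a | k ≟ b
  ... | yes _ | _     = refl
  ... | no _  | yes _ = refl
  ... | no _  | no _  with compare 0ℝ (entry X a k) | compare 0ℝ (entry X k b)
  ...   | tri< _ _ _ | tri< _ _ _ = refl
  ...   | tri< _ _ _ | tri≈ _ _ _ = refl
  ...   | tri< _ _ _ | tri> _ _ _ = refl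
  ...   | tri≈ _ _ _ | tri< _ _ _ = refl
  ...   | tri≈ _ _ _ | tri≈ _ _ _ = refl
  ...   | tri≈ _ _ _ | tri> _ _ _ = refl
  ...   | tri> _ _ _ | tri< _ _ _ = refl
  ...   | tri> _ _ _ | tri≈ _ _ _ = refl
  ...   | tri> _ _ _ | tri> _ _ _ = refl

  mutationRule-sameSign : ∀ {n} {k a b : Fin n} σ {x u v} → k ≢ a → k ≢ b →
    StrictSign σ u → StrictSign σ v → mutationRule k a b x u v ≡ x + signed σ (u * v)
  mutationRule-sameSign {k = k} {a} {b} σ {u = u} {v} k≢a k≢b u-sign v-sign with k ≟ a | k ≟ b
  ... | yes k≡a | _       = ⊥-elim (k≢a k≡a)
  ... | no _    | yes k≡b = ⊥-elim (k≢b k≡b)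
  ... | no _    | no _    with σ | compare 0ℝ u | compare 0ℝ v
  ...   | true  | tri< _ _ _  | tri< _ _ _  = refl
  ...   | true  | tri< _ _ _  | tri≈ v≯0 _ _ = ⊥-elim (v≯0 v-sign)
  ...   | true  | tri< _ _ _  | tri> v≯0 _ _ = ⊥-elim (v≯0 v-sign)
  ...   | true  | tri≈ u≯0 _ _ | _          = ⊥-elim (u≯0 u-sign)
  ...   | true  | tri> u≯0 _ _ | _          = ⊥-elim (u≯0 u-sign)
  ...   | false | tri> _ _ _  | tri> _ _ _  = refl
  ...   | false | tri> _ _ _  | tri≈ _ _ v≮0 = ⊥-elim (v≮0 v-sign)
  ...   | false | tri> _ _ _  | tri< _ _ v≮0 = ⊥-elim (v≮0 v-sign)
  ...   | false | tri≈ _ _ u≮0 | _          = ⊥-elim (u≮0 u-sign)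
  ...   | false | tri< _ _ u≮0 | _          = ⊥-elim (u≮0 u-sign)

  mutationRule-cong : ∀ {n} (k a b : Fin n) {x x' u u' v v'} → x ≡ x' → u ≡ u' → v ≡ v' →
    mutationRule k a b x u v ≡ mutationRule k a b x' u' v'
  mutationRule-cong k a b refl refl refl = refl

  entry-update : ∀ {n} (X : U n) {i j} c a b → (a , b) ≢ (i , j) → (b , a) ≢ (i , j) →
    entry (update X i j c) a b ≡ entry X a b
  entry-update X c a b ab≢ij ba≢ij with <-cmp a b
  ... | tri< q _ _ = update-other X c q ab≢ij
  ... | tri≈ _ _ _ = refl
  ... | tri> _ _ q = cong -_ (update-other X c q ba≢ij)

  module _ {n} {i j k : Fin n} (k≢i : k ≢ i) (k≢j : k ≢ j) (X : U n) (c : ℝ) where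
    private
      entry-update-ak : ∀ a → entry (update X i j c) a k ≡ entry X a k
      entry-update-ak a = entry-update X c a k (k≢j ∘ cong proj₂) (k≢i ∘ cong proj₁)

      entry-update-kb : ∀ b → entry (update X i j c) k b ≡ entry X k b
      entry-update-kb b = entry-update X c k b (k≢i ∘ cong proj₁) (k≢j ∘ cong proj₂)

    μ-update : μ k (update X i j c) ≐ update (μ k X) i j (mutationRule k i j c (entry X i k) (entry X k j))
    μ-update a b q with (a , b) ≟₂ (i , j)
    ... | yes refl = trans (μ-unfold k _ a b q)
                       (mutationRule-cong k a b (update-same X c q) (entry-update-ak a) (entry-update-kb b))
    ... | no ab≢ij = trans (μ-unfold k _ a b q)
                       (trans (mutationRule-cong k a b (update-other X c q ab≢ij) (entry-update-ak a) (entry-update-kb b))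
                              (sym (μ-unfold k X a b q)))

module Invariance (R : Reals) where
  open Reals R
  open OrderedField R
  open PolynomialFunctions R
  open Quivers R
  open Coordinates
  open QuiverPolynomials R
  open Mutation R

  isNonneg : ℝ → Bool
  isNonneg x with compare 0ℝ x
  ... | tri> _ _ _ = false
  ... | _          = true

  weakSign-isNonneg : ∀ x → WeakSign (isNonneg x) x
  weakSign-isNonneg x with compare 0ℝ x
  ... | tri< 0<x _ _ = inj₁ 0<x
  ... | tri≈ _ 0≡x _ = inj₂ 0≡x
  ... | tri> _ _ x<0 = inj₁ x<0

  carriageOf : ∀ {n} → U n → SignPattern n
  carriageOf X a b q = isNonneg (X a b q)

  ∈carriageOf : ∀ {n} (X : U n) → X ∈Carriage carriageOf X
  ∈carriageOf X a b q = weakSign-isNonneg (X a b q)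

  ∈Carriage-resp : ∀ {n} {X Y : U n} {s} → X ≐ Y → Y ∈Carriage s → X ∈Carriage s
  ∈Carriage-resp {s = s} X≐Y Y∈s a b q = subst (WeakSign (s a b q)) (sym (X≐Y a b q)) (Y∈s a b q)

  update-∈Carriage : ∀ {n} {X : U n} {s i j c} →
    (∀ a b q → (a , b) ≢ (i , j) → WeakSign (s a b q) (X a b q)) → (∀ q → WeakSign (s i j q) c) →
    update X i j c ∈Carriage s
  update-∈Carriage {i = i} {j} X-sign c-sign a b q with (a , b) ≟₂ (i , j)
  ... | yes refl  = c-sign q
  ... | no ab≢ij = X-sign a b q ab≢ij

  update-∈Carriage-update : ∀ {n} {X : U n} {s i j c β} → X ∈Carriage s → WeakSign β c →
    update X i j c ∈Carriage update s i j β
  update-∈Carriage-update {i = i} {j} X∈s c-sign a b q with (a , b) ≟₂ (i , j)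
  ... | yes _ = c-sign
  ... | no _  = X∈s a b q

  entry-strict : ∀ {n s L} {X : U n} → StrictExcept s L X → ∀ {a b} →
    (a , b) ∉ L → (b , a) ∉ L → a ≢ b → StrictSign (signEntry s a b) (entry X a b)
  entry-strict {s = s} X∈ {a} {b} ab∉ ba∉ a≢b with <-cmp a b
  ... | tri< q _ _   = X∈ a b q ab∉
  ... | tri≈ _ a≡b _ = ⊥-elim (a≢b a≡b)
  ... | tri> _ _ q   = strict-neg (s b a q) (X∈ b a q ba∉)

  module _ {n} (F : U n → ℝ) (P : SignPattern n → Poly n)
    (F≡P : CarriagewisePolynomial F P) (F∘μ≡F : MutationInvariant F)
    {s₁ : SignPattern n} {i j k : Fin n} (p : i Fin.< j) (k≢i : k ≢ i) (k≢j : k ≢ j) where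

    private
      ∉[ij] : ∀ {a b} → (a , b) ≢ (i , j) → (a , b) ∉ [ (i , j) ]
      ∉[ij] ab≢ij (here ab≡ij) = ab≢ij ab≡ij

    module _ {X : U n} (X∈ : StrictExcept s₁ [ (i , j) ] X) {σ}
      (ik-sign : StrictSign σ (entry X i k)) (kj-sign : StrictSign σ (entry X k j)) where

      δ : ℝ
      δ = signed σ (entry X i k * entry X k j)

      T : SignPattern n
      T = update (carriageOf (μ k X)) i j σ

      μ-translate : ∀ c → μ k (update X i j c) ≐ update (μ k X) i j (c + δ)
      μ-translate c a b q = trans (μ-update k≢i k≢j X c a b q)
        (cong (λ x → update (μ k X) i j x a b q) (mutationRule-sameSign σ k≢i k≢j ik-sign kj-sign))

      translate-agree : ∀ s → (∀ a b q → (a , b) ≢ (i , j) → s a b q ≡ s₁ a b q) → ∀ c →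
        eval (P s) (update X i j c) ≡ eval (P T) (update (μ k X) i j (c + δ))
      translate-agree s s≡s₁ =
        agree (eval-update-degree₀ (P s) X i j) (eval-update-degree (P T) (μ k X) i j δ)
              (proj₁ points) (proj₁ (proj₂ points)) at-points
        where
        points = translation-points σ (strict-signed σ (strict-*-strict σ ik-sign kj-sign)) (s i j p)
        at-points : ∀ m → let c = proj₁ points m in
          eval (P s) (update X i j c) ≡ eval (P T) (update (μ k X) i j (c + δ))
        at-points m = begin
          eval (P s) (update X i j c)                ≡⟨ F≡P s _ source∈s ⟨
          F (update X i j c)                         ≡⟨ F∘μ≡F _ k ⟨
          F (μ k (update X i j c))                   ≡⟨ F≡P T _ (∈Carriage-resp (μ-translate c) image∈T) ⟩
          eval (P T) (μ k (update X i j c))          ≡⟨ eval-cong (P T) (μ-translate c) ⟩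
          eval (P T) (update (μ k X) i j (c + δ))    ∎
          where
          open ≡-Reasoning
          c = proj₁ points m
          source∈s : update X i j c ∈Carriage s
          source∈s = update-∈Carriage
            (λ a b q ab≢ij → subst (λ β → WeakSign β (X a b q)) (sym (s≡s₁ a b q ab≢ij))
                                   (strict⇒weak _ (X∈ a b q (∉[ij] ab≢ij))))
            (λ q → subst (λ r → WeakSign (s i j r) c) (<-irrelevant p q) (proj₁ (proj₂ (proj₂ points) m)))
          image∈T : update (μ k X) i j (c + δ) ∈Carriage T
          image∈T = update-∈Carriage-update (∈carriageOf (μ k X)) (proj₂ (proj₂ (proj₂ points) m))

      -- Only the agreement of s₁ and s₂ away from (i, j) is used.
      agree-at : ∀ {s₂} → DifferExactlyAt s₁ s₂ i j p → eval (P s₁) X ≡ eval (P s₂) X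
      agree-at {s₂} (_ , s₁≡s₂) = begin
        eval (P s₁) X                                  ≡⟨ eval-cong (P s₁) (update-self X p) ⟨
        eval (P s₁) (update X i j (X i j p))           ≡⟨ translate-agree s₁ (λ _ _ _ _ → refl) _ ⟩
        eval (P T) (update (μ k X) i j (X i j p + δ))  ≡⟨ translate-agree s₂ s₂≡s₁ _ ⟨
        eval (P s₂) (update X i j (X i j p))           ≡⟨ eval-cong (P s₂) (update-self X p) ⟩
        eval (P s₂) X                                  ∎
        where
        open ≡-Reasoning
        s₂≡s₁ : ∀ a b q → (a , b) ≢ (i , j) → s₂ a b q ≡ s₁ a b q
        s₂≡s₁ a b q ab≢ij = sym (s₁≡s₂ a b q (ab≢ij ∘ ×-≡,≡→≡))

    agree-on-region : signEntry s₁ i k ≡ signEntry s₁ k j → ∀ {s₂} → DifferExactlyAt s₁ s₂ i j p →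
      AgreeOn (P s₁) (P s₂) s₁ [ (i , j) ]
    agree-on-region same-sign diff X X∈ = agree-at X∈ {σ = signEntry s₁ k j}
      (subst (λ σ → StrictSign σ (entry X i k)) same-sign
        (entry-strict X∈ (∉[ij] (k≢j ∘ cong proj₂)) (∉[ij] (k≢i ∘ cong proj₁)) (k≢i ∘ sym)))
      (entry-strict X∈ (∉[ij] (k≢i ∘ cong proj₁)) (∉[ij] (k≢j ∘ cong proj₂)) k≢j)
      diff

lemma1 : (R : Reals) → ∀ {n} (F : Quivers.U R n → Reals.ℝ R)
    (P : Quivers.SignPattern R n → Quivers.Poly R n) →
    Quivers.CarriagewisePolynomial R F P → Quivers.MutationInvariant R F →
    ∀ (s₁ s₂ : Quivers.SignPattern R n) (i j : Fin n) (p : i Fin.< j) →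
    Quivers.DifferExactlyAt R s₁ s₂ i j p →
    Σ (Fin n) (λ k → k ≢ i × k ≢ j × Quivers.signEntry R s₁ i k ≡ Quivers.signEntry R s₁ k j) →
    ∀ (X : Quivers.U R n) → Quivers.eval R (P s₁) X ≡ Quivers.eval R (P s₂) X
lemma1 R F P F≡P F∘μ≡F s₁ s₂ i j p diff (k , k≢i , k≢j , same-sign) =
  QuiverPolynomials.polynomial-identity R (P s₁) (P s₂) s₁
    (Invariance.agree-on-region R F P F≡P F∘μ≡F p k≢i k≢j same-sign diff)
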